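{- Let $A[1..n]$ be an array of distinct numbers, $k\ge 1$ an integer, and $1\le j\le n$. Let $i_1,\dots,i_{j'}$ be the active indices of $S_k(j)$. Then the total ordering of the values $A[i_1],\dots,A[i_{j'}]$ can be recovered from $S_k(j)$ alone.
   Context: For $1\le j\le n$, the dominance graph $G_j$ of $A[1..j]$ is the directed graph on vertices $\{1,\dots,j\}$ with an edge $(i',j')$ iff $i'<j'$ and $A[i']<A[j']$. Let $d_j(\ell)$ be the out-degree of $\ell$ in $G_j$ (the number of positions $\ell'\in(\ell,j]$ with $A[\ell']>A[\ell]$). The structure $S_k(j)$ is the array of length $j$ with $S_k(j,\ell)=\min(d_j(\ell),k)$ for $1\le \ell\le j$. An index $\ell$ is active in $S_k(j)$ iff $S_k(j,\ell)<k$, and inactive otherwise. -}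

module Defs where

open import Level using (Level)
open import Data.Nat as ℕ using (ℕ; _⊓_)
open import Data.Fin using (Fin; toℕ; inject≤)
open import Data.List using (length; filter; allFin)
open import Relation.Nullary.Decidable using (_×-dec_)
open import Relation.Binary.Bundles using (StrictTotalOrder)

module Dominance {a ℓ₁ ℓ₂ : Level} (O : StrictTotalOrder a ℓ₁ ℓ₂) where
  open StrictTotalOrder O using (Carrier; _<_; _<?_)

  -- Positions are 0-indexed: Fin n position p corresponds to paper index p+1.
  -- The prefix A[1..j] consists of positions p with toℕ p < j.

  outdeg : {n : ℕ} → (Fin n → Carrier) → ℕ → Fin n → ℕ
  outdeg {n} A j p =
    length (filter (λ q → (toℕ p ℕ.<? toℕ q) ×-dec ((toℕ q ℕ.<? j) ×-dec (A p <? A q)))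
                   (allFin n))

  S : {n : ℕ} → (k : ℕ) → (A : Fin n → Carrier) → (j : ℕ) → j ℕ.≤ n → Fin j → ℕ
  S k A j j≤n p = outdeg A j (inject≤ p j≤n) ⊓ k

  Active : {j : ℕ} → (k : ℕ) → (Fin j → ℕ) → Fin j → Set
  Active k s p = s p ℕ.< k

-- For active positions p < q of the prefix, A[p] < A[q] holds exactly when the out-degree of p is at
-- least the number of active positions r > p with A[r] ≥ A[q]: if A[p] < A[q] every such r dominates p,
-- while if A[q] < A[p] every position dominating p is active (its out-degree is smaller than that of p)
-- and lies above A[q], and q itself is counted on top. Out-degrees of active positions can be read off
-- S_k(j), and the count only involves the order among active positions to the right of p, so the order
-- on active positions is recovered by downward induction on p.
module Submission where

open import Defs
open import Level using (Level)
open import Data.Nat using (ℕ; zero; suc; s≤s; s<s⁻¹; _≤_; _<_; _<?_; _⊓_)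
open import Data.Nat.Properties
  using (<-trans; <-irrefl; <-cmp; <⇒≤; <⇒≢; <⇒≱; ≰⇒>; ≤∧≢⇒<; n≮0; m≤n⇒m⊓n≡m; m≥n⇒m⊓n≡n; m<n⇒m⊓o<n)
open import Data.Fin as Fin using (Fin; toℕ; inject≤)
open import Data.Fin.Properties using (toℕ<n; toℕ-injective; toℕ-inject≤; inject≤-injective)
open import Data.Fin.Induction using (>-wellFounded)
open import Data.List using (List; []; _∷_; length; filter; map; tabulate; allFin)
open import Data.List.Properties using (filter-none; filter-≐; map-tabulate)
open import Data.List.Membership.Propositional using (_∈_)
open import Data.List.Membership.Propositional.Properties using (∈-filter⁺; ∈-filter⁻; ∈-allFin)
open import Data.List.Relation.Unary.All.Properties using (tabulate⁺)
open import Data.List.Relation.Binary.Pointwise using (Pointwise-≡⇒≡)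
open import Data.List.Relation.Binary.Sublist.Propositional using (⊆-refl) renaming (_⊆_ to _⊑_)
open import Data.List.Relation.Binary.Sublist.Propositional.Properties using (filter⁺)
open import Data.List.Relation.Binary.Sublist.Heterogeneous.Properties using (length-mono-≤; toPointwise)
open import Data.Product using (_×_; _,_; proj₂)
open import Function using (_∘_; id)
open import Function.Bundles using (_⇔_; mk⇔; Equivalence)
open import Function.Definitions using (Injective)
open import Function.Properties.Equivalence using () renaming (refl to ⇔-refl; sym to ⇔-sym; trans to ⇔-trans)
open import Function.Related.TypeIsomorphisms using (¬-cong-⇔)
open import Induction.WellFounded using (module All)
open import Relation.Nullary using (¬_; ¬?; yes; no; contradiction)
open import Relation.Nullary.Decidable using (_×-dec_)
open import Relation.Unary using (Pred; Decidable; _⊆_)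
open import Relation.Binary.Bundles using (StrictTotalOrder)
open import Relation.Binary.Definitions using (tri<; tri≈; tri>)
open import Relation.Binary.PropositionalEquality
  using (_≡_; _≢_; refl; sym; cong; subst; subst₂; module ≡-Reasoning)

module _ {a p q} {X : Set a} {P : Pred X p} {Q : Pred X q}
         (P? : Decidable P) (Q? : Decidable Q) (P⊆Q : P ⊆ Q) where

  filter-⊑ : ∀ xs → filter P? xs ⊑ filter Q? xs
  filter-⊑ xs = filter⁺ P? Q? {as = xs} {bs = xs} (λ { refl → P⊆Q }) ⊆-refl

  length-filter-mono : ∀ xs → length (filter P? xs) ≤ length (filter Q? xs)
  length-filter-mono xs = length-mono-≤ (filter-⊑ xs)

  -- Equal lengths would force the two filtered lists to coincide, yet only one of them contains x.
  length-filter-mono-< : ∀ {x xs} → x ∈ xs → ¬ P x → Q x → length (filter P? xs) < length (filter Q? xs)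
  length-filter-mono-< {x} {xs} x∈xs ¬Px Qx = ≤∧≢⇒< (length-filter-mono xs) λ same-length →
    ¬Px (proj₂ (∈-filter⁻ P? {xs = xs}
      (subst (x ∈_) (sym (Pointwise-≡⇒≡ (toPointwise same-length (filter-⊑ xs)))) (∈-filter⁺ Q? x∈xs Qx))))

module _ {a p} {X : Set a} {P : Pred X p} (P? : Decidable P) where

  length-filter-map : ∀ {b} {Y : Set b} (g : Y → X) (ys : List Y) →
                      length (filter P? (map g ys)) ≡ length (filter (P? ∘ g) ys)
  length-filter-map g [] = refl
  length-filter-map g (y ∷ ys) with P? (g y)
  ... | yes _ = cong suc (length-filter-map g ys)
  ... | no _  = length-filter-map g ys

  length-filter-tabulate-inject≤ : ∀ {j n} (j≤n : j ≤ n) (h : Fin n → X) →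
    (∀ i → P (h i) → toℕ i < j) →
    length (filter P? (tabulate h)) ≡ length (filter P? (tabulate (λ i → h (inject≤ i j≤n))))
  length-filter-tabulate-inject≤ {zero} _ h below =
    cong length (filter-none P? (tabulate⁺ λ i Phi → n≮0 (below i Phi)))
  length-filter-tabulate-inject≤ {suc j} {suc n} (s≤s j≤n) h below with P? (h Fin.zero)
  ... | yes _ = cong suc (length-filter-tabulate-inject≤ j≤n (h ∘ Fin.suc) (λ i → s<s⁻¹ ∘ below (Fin.suc i)))
  ... | no _  = length-filter-tabulate-inject≤ j≤n (h ∘ Fin.suc) (λ i → s<s⁻¹ ∘ below (Fin.suc i))

m⊓n<n⇒m<n : ∀ {m n} → m ⊓ n < n → m < n
m⊓n<n⇒m<n m⊓n<n = ≰⇒> λ n≤m → <-irrefl (m≥n⇒m⊓n≡n n≤m) m⊓n<n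

⊓-cancelʳ-< : ∀ {m n o} → m ⊓ o ≡ n ⊓ o → m < o → m ≡ n
⊓-cancelʳ-< {m} {n} {o} eq m<o = begin
  m      ≡⟨ m≤n⇒m⊓n≡m (<⇒≤ m<o) ⟨
  m ⊓ o  ≡⟨ eq ⟩
  n ⊓ o  ≡⟨ m≤n⇒m⊓n≡m (<⇒≤ n<o) ⟩
  n      ∎
  where
  open ≡-Reasoning
  n<o : n < o
  n<o = m⊓n<n⇒m<n (subst (_< o) eq (m<n⇒m⊓o<n o m<o))

module _ {a ℓ₁ ℓ₂} (O : StrictTotalOrder a ℓ₁ ℓ₂) where
  open StrictTotalOrder O renaming (_<_ to _≺_; _<?_ to _≺?_)
  open Dominance O using (outdeg)

  ≺-⊀-trans : ∀ {x y z} → x ≺ y → ¬ z ≺ y → x ≺ z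
  ≺-⊀-trans {y = y} {z = z} x≺y z⊀y with compare z y
  ... | tri< z≺y _ _ = contradiction z≺y z⊀y
  ... | tri≈ _ z≈y _ = <-respʳ-≈ (Eq.sym z≈y) x≺y
  ... | tri> _ _ y≺z = trans x≺y y≺z

  ⊀⇔≻ : ∀ {x y} → ¬ x ≈ y → (¬ x ≺ y) ⇔ y ≺ x
  ⊀⇔≻ {x} {y} x≉y = mk⇔ ⊀⇒≻ (λ y≺x x≺y → asym x≺y y≺x)
    where
    ⊀⇒≻ : ¬ x ≺ y → y ≺ x
    ⊀⇒≻ x⊀y with compare x y
    ... | tri< x≺y _ _ = contradiction x≺y x⊀y
    ... | tri≈ _ x≈y _ = contradiction x≈y x≉y
    ... | tri> _ _ y≺x = y≺x

  outdeg-inject≤ : ∀ {j n} (A : Fin n → Carrier) (j≤n : j ≤ n) (p : Fin j) →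
                   outdeg A j (inject≤ p j≤n) ≡ outdeg (λ i → A (inject≤ i j≤n)) j p
  outdeg-inject≤ {j} {n} A j≤n p = begin
    length (filter R? (allFin n))          ≡⟨ length-filter-tabulate-inject≤ R? j≤n id (λ _ (_ , q<j , _) → q<j) ⟩
    length (filter R? (tabulate ι))        ≡⟨ cong (length ∘ filter R?) (map-tabulate id ι) ⟨
    length (filter R? (map ι (allFin j)))  ≡⟨ length-filter-map R? ι (allFin j) ⟩
    length (filter (R? ∘ ι) (allFin j))    ≡⟨ cong length (filter-≐ (R? ∘ ι) _ (to , from) (allFin j)) ⟩
    outdeg (A ∘ ι) j p                     ∎
    where
    open ≡-Reasoning
    ι : Fin j → Fin n
    ι i = inject≤ i j≤n
    R : Pred (Fin n) ℓ₂
    R q = toℕ (ι p) < toℕ q × toℕ q < j × A (ι p) ≺ A q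
    R? : Decidable R
    R? q = (toℕ (ι p) <? toℕ q) ×-dec ((toℕ q <? j) ×-dec (A (ι p) ≺? A q))
    to : ∀ {q} → R (ι q) → toℕ p < toℕ q × toℕ q < j × A (ι p) ≺ A (ι q)
    to {q} (p<q , _ , Ap≺Aq) = subst₂ _<_ (toℕ-inject≤ p j≤n) (toℕ-inject≤ q j≤n) p<q , toℕ<n q , Ap≺Aq
    from : ∀ {q} → toℕ p < toℕ q × toℕ q < j × A (ι p) ≺ A (ι q) → R (ι q)
    from {q} (p<q , _ , Ap≺Aq) =
      subst₂ _<_ (sym (toℕ-inject≤ p j≤n)) (sym (toℕ-inject≤ q j≤n)) p<q ,
      subst (_< j) (sym (toℕ-inject≤ q j≤n)) (toℕ<n q) , Ap≺Aq

module ActiveOrder {a ℓ₁ ℓ₂} (O : StrictTotalOrder a ℓ₁ ℓ₂) (k : ℕ) {j : ℕ}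
                   (f : Fin j → StrictTotalOrder.Carrier O)
                   (f-injective : Injective _≡_ (StrictTotalOrder._≈_ O) f) where
  open StrictTotalOrder O renaming (_<_ to _≺_; _<?_ to _≺?_)
  open Dominance O using (outdeg)

  IsActive : Fin j → Set
  IsActive p = outdeg f j p < k

  activeNotBelow : Fin j → Fin j → ℕ
  activeNotBelow p q =
    length (filter (λ r → (toℕ p <? toℕ r) ×-dec ((outdeg f j r <? k) ×-dec ¬? (f r ≺? f q))) (allFin j))

  outdeg-dominated : ∀ {p r} → toℕ p < toℕ r → f p ≺ f r → outdeg f j r < outdeg f j p
  outdeg-dominated {p} {r} p<r fp≺fr =
    length-filter-mono-< _ _ (λ (r<s , s<j , fr≺fs) → <-trans p<r r<s , s<j , trans fp≺fr fr≺fs)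
      (∈-allFin r) (λ (r<r , _) → <-irrefl refl r<r) (p<r , toℕ<n r , fp≺fr)

  ≺⇒activeNotBelow≤outdeg : ∀ {p q} → f p ≺ f q → activeNotBelow p q ≤ outdeg f j p
  ≺⇒activeNotBelow≤outdeg fp≺fq =
    length-filter-mono _ _ (λ {r} (p<r , _ , fr⊀fq) → p<r , toℕ<n r , ≺-⊀-trans O fp≺fq fr⊀fq) (allFin j)

  ≻⇒outdeg<activeNotBelow : ∀ {p q} → toℕ p < toℕ q → IsActive p → IsActive q → f q ≺ f p →
                            outdeg f j p < activeNotBelow p q
  ≻⇒outdeg<activeNotBelow {p} {q} p<q p-active q-active fq≺fp =
    length-filter-mono-< _ _
      (λ (p<r , _ , fp≺fr) → p<r , <-trans (outdeg-dominated p<r fp≺fr) p-active , asym (trans fq≺fp fp≺fr))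
      (∈-allFin q) (λ (_ , _ , fp≺fq) → asym fp≺fq fq≺fp) (p<q , q-active , irrefl Eq.refl)

  ≺⇔activeNotBelow≤outdeg : ∀ {p q} → toℕ p < toℕ q → IsActive p → IsActive q →
                            f p ≺ f q ⇔ activeNotBelow p q ≤ outdeg f j p
  ≺⇔activeNotBelow≤outdeg {p} {q} p<q p-active q-active = mk⇔ ≺⇒activeNotBelow≤outdeg from
    where
    from : activeNotBelow p q ≤ outdeg f j p → f p ≺ f q
    from count≤ with compare (f p) (f q)
    ... | tri< fp≺fq _ _ = fp≺fq
    ... | tri≈ _ fp≈fq _ = contradiction (cong toℕ (f-injective fp≈fq)) (<⇒≢ p<q)
    ... | tri> _ _ fq≺fp = contradiction count≤ (<⇒≱ (≻⇒outdeg<activeNotBelow p<q p-active q-active fq≺fp))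

  ⊀⇔≻-distinct : ∀ {p q} → p ≢ q → (¬ f p ≺ f q) ⇔ f q ≺ f p
  ⊀⇔≻-distinct p≢q = ⊀⇔≻ O (p≢q ∘ f-injective)

module Agreement {a ℓ₁ ℓ₂} (O : StrictTotalOrder a ℓ₁ ℓ₂) (k : ℕ) {j : ℕ}
                 (f g : Fin j → StrictTotalOrder.Carrier O)
                 (f-injective : Injective _≡_ (StrictTotalOrder._≈_ O) f)
                 (g-injective : Injective _≡_ (StrictTotalOrder._≈_ O) g)
                 (same-S : ∀ p → Dominance.outdeg O f j p ⊓ k ≡ Dominance.outdeg O g j p ⊓ k) where
  open StrictTotalOrder O renaming (_<_ to _≺_; _<?_ to _≺?_)
  open Dominance O using (outdeg)
  open All (>-wellFounded {j}) ℓ₂ using (wfRec)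
  module F = ActiveOrder O k f f-injective
  module G = ActiveOrder O k g g-injective

  outdeg-agree : ∀ {p} → F.IsActive p → outdeg f j p ≡ outdeg g j p
  outdeg-agree {p} = ⊓-cancelʳ-< (same-S p)

  F-active⇒G-active : ∀ {p} → F.IsActive p → G.IsActive p
  F-active⇒G-active p-active = subst (_< k) (outdeg-agree p-active) p-active

  G-active⇒F-active : ∀ {p} → G.IsActive p → F.IsActive p
  G-active⇒F-active {p} p-active = subst (_< k) (⊓-cancelʳ-< (sym (same-S p)) p-active) p-active

  Agree : Fin j → Fin j → Set ℓ₂
  Agree r s = f r ≺ f s ⇔ g r ≺ g s

  agree-refl : ∀ {r} → Agree r r
  agree-refl = mk⇔ (λ fr≺fr → contradiction fr≺fr (irrefl Eq.refl))
                   (λ gr≺gr → contradiction gr≺gr (irrefl Eq.refl))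

  agree-flip : ∀ {r s} → r ≢ s → Agree r s → Agree s r
  agree-flip r≢s r~s =
    ⇔-trans (⇔-sym (F.⊀⇔≻-distinct r≢s)) (⇔-trans (¬-cong-⇔ r~s) (G.⊀⇔≻-distinct r≢s))

  AgreeAfter : Fin j → Set ℓ₂
  AgreeAfter p = ∀ {q} → toℕ p < toℕ q → F.IsActive p → F.IsActive q → Agree p q

  agree-from-after : ∀ {r s} → AgreeAfter r → AgreeAfter s → F.IsActive r → F.IsActive s → Agree r s
  agree-from-after {r} {s} r-after s-after r-active s-active with <-cmp (toℕ r) (toℕ s)
  ... | tri< r<s _ _ = r-after r<s r-active s-active
  ... | tri≈ _ r≡s _ = subst (Agree r) (toℕ-injective r≡s) agree-refl
  ... | tri> _ r≢s s<r = agree-flip (r≢s ∘ cong toℕ ∘ sym) (s-after s<r s-active r-active)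

  activeNotBelow-agree : ∀ {p q} → (∀ {r} → toℕ p < toℕ r → F.IsActive r → Agree r q) →
                         F.activeNotBelow p q ≡ G.activeNotBelow p q
  activeNotBelow-agree {p} {q} later-agree = cong length (filter-≐ _ _ (to , from) (allFin j))
    where
    to : ∀ {r} → toℕ p < toℕ r × F.IsActive r × ¬ f r ≺ f q → toℕ p < toℕ r × G.IsActive r × ¬ g r ≺ g q
    to (p<r , r-active , fr⊀fq) =
      p<r , F-active⇒G-active r-active , fr⊀fq ∘ Equivalence.from (later-agree p<r r-active)
    from : ∀ {r} → toℕ p < toℕ r × G.IsActive r × ¬ g r ≺ g q → toℕ p < toℕ r × F.IsActive r × ¬ f r ≺ f q
    from (p<r , r-active , gr⊀gq) =
      p<r , G-active⇒F-active r-active , gr⊀gq ∘ Equivalence.to (later-agree p<r (G-active⇒F-active r-active))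

  agreeAfter-step : ∀ {p} → (∀ {r} → toℕ p < toℕ r → AgreeAfter r) → AgreeAfter p
  agreeAfter-step {p} later {q} p<q p-active q-active =
    ⇔-trans (F.≺⇔activeNotBelow≤outdeg p<q p-active q-active) (⇔-trans same-test
      (⇔-sym (G.≺⇔activeNotBelow≤outdeg p<q (F-active⇒G-active p-active) (F-active⇒G-active q-active))))
    where
    same-test : F.activeNotBelow p q ≤ outdeg f j p ⇔ G.activeNotBelow p q ≤ outdeg g j p
    same-test = subst₂ (λ c d → F.activeNotBelow p q ≤ outdeg f j p ⇔ c ≤ d)
      (activeNotBelow-agree λ p<r r-active → agree-from-after (later p<r) (later p<q) r-active q-active)
      (outdeg-agree p-active) ⇔-refl

  agreeAfter : ∀ p → AgreeAfter p
  agreeAfter = wfRec AgreeAfter (λ _ later → agreeAfter-step later)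

  agree : ∀ {r s} → F.IsActive r → F.IsActive s → Agree r s
  agree {r} {s} = agree-from-after (agreeAfter r) (agreeAfter s)

lemma4 : {a ℓ₁ ℓ₂ : Level} (O : StrictTotalOrder a ℓ₁ ℓ₂) →
         (k : ℕ) → 1 ≤ k →
         (n m j : ℕ) → 1 ≤ j → (j≤n : j ≤ n) → (j≤m : j ≤ m) →
         (A : Fin n → StrictTotalOrder.Carrier O) → (B : Fin m → StrictTotalOrder.Carrier O) →
         Injective _≡_ (StrictTotalOrder._≈_ O) A → Injective _≡_ (StrictTotalOrder._≈_ O) B →
         (∀ p → Dominance.S O k A j j≤n p ≡ Dominance.S O k B j j≤m p) →
         ∀ p q → Dominance.Active O k (Dominance.S O k A j j≤n) p →
         Dominance.Active O k (Dominance.S O k A j j≤n) q →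
         (StrictTotalOrder._<_ O (A (inject≤ p j≤n)) (A (inject≤ q j≤n)) ⇔
          StrictTotalOrder._<_ O (B (inject≤ p j≤m)) (B (inject≤ q j≤m)))
lemma4 O k _ n m j _ j≤n j≤m A B A-injective B-injective same-S p q p-active q-active =
  Agreement.agree O k A′ B′
    (inject≤-injective j≤n j≤n _ _ ∘ A-injective) (inject≤-injective j≤m j≤m _ _ ∘ B-injective)
    same-prefix-S (prefix-active p-active) (prefix-active q-active)
  where
  open Dominance O using (outdeg)
  A′ : Fin j → StrictTotalOrder.Carrier O
  A′ i = A (inject≤ i j≤n)
  B′ : Fin j → StrictTotalOrder.Carrier O
  B′ i = B (inject≤ i j≤m)
  same-prefix-S : ∀ p → outdeg A′ j p ⊓ k ≡ outdeg B′ j p ⊓ k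
  same-prefix-S p =
    subst₂ (λ x y → x ⊓ k ≡ y ⊓ k) (outdeg-inject≤ O A j≤n p) (outdeg-inject≤ O B j≤m p) (same-S p)
  prefix-active : ∀ {p} → Dominance.Active O k (Dominance.S O k A j j≤n) p → outdeg A′ j p < k
  prefix-active {p} = subst (_< k) (outdeg-inject≤ O A j≤n p) ∘ m⊓n<n⇒m<n
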